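{- Let $d\ge3$ be odd and $\mu$ a bar partition. Let $x_i$ be the number of beads on runner $i$ ($0\le i\le d-1$) of the minimally normalized $d$-abacus of the doubled partition $D(\mu)$. Then for all $0\le i,j\le d-1$ we have $x_i+x_{i^*}=x_j+x_{j^*}$.
   Context: $\mu=(a_1>\dots>a_m>0)$ is a partition into distinct parts. $D(\mu)$ is the partition with Frobenius symbol $(a_1,\dots,a_m\mid a_1-1,\dots,a_m-1)$; for $r\le m$, row $r$ has length $a_r+r$ and column $r$ has length $a_r+r-1$. For a partition $\nu$, let $k$ be the least multiple of $d$ that is at least the number of nonzero parts of $\nu$. The minimally normalized $\beta$-set of $\nu$ is $X=\{\nu_s+k-s\mid 1\le s\le k\}$, and runner $i$ of its $d$-abacus holds the beads $\{x\in X\mid x\equiv i \bmod d\}$. $i^*=d-i$ for $1\le i\le d-1$, and $0^*=0$. -}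

module Defs where

open import Data.Nat using (ℕ; zero; suc; _+_; _*_; _∸_; _≤_; _<_; _>_; _≤ᵇ_; _≡ᵇ_; NonZero)
open import Data.Nat.DivMod using (_/_; _%_)
open import Data.Bool using (Bool; true; false; if_then_else_; not)
open import Data.List using (List; []; _∷_; length; filter; map; upTo)
open import Data.Nat.ListAction using (sum)
open import Data.List.Relation.Unary.All using (All)
open import Data.List.Relation.Unary.Linked using (Linked)
open import Data.Product using (∃; _×_)
open import Relation.Binary.PropositionalEquality using (_≡_)
open import Relation.Nullary.Decidable using (does)
open import Data.Nat using (_≟_)

Odd : ℕ → Set
Odd d = ∃ λ k → d ≡ suc (2 * k)

IsBarPartition : List ℕ → Set
IsBarPartition μ = Linked _>_ μ × All (0 <_) μ

-- 1-indexed entry of a list, 0 beyond its length (parts of a partition)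
at : List ℕ → ℕ → ℕ
at []       _             = 0
at (x ∷ xs) zero          = 0
at (x ∷ xs) (suc zero)    = x
at (x ∷ xs) (suc (suc n)) = at xs (suc n)

countUpTo : ℕ → (ℕ → Bool) → ℕ
countUpTo zero    p = 0
countUpTo (suc n) p = countUpTo n p + (if p (suc n) then 1 else 0)

-- Row r (1-indexed) of the partition with Frobenius symbol
-- (a₁,…,aₘ ∣ a₁-1,…,aₘ-1):  for r ≤ m it is aᵣ + r ;  for r > m it is the
-- number of columns j ≤ m whose length (aⱼ - 1) + j is at least r.
DRow : List ℕ → ℕ → ℕ
DRow μ r =
  if r ≤ᵇ length μ
  then at μ r + r
  else countUpTo (length μ) (λ j → r ≤ᵇ (at μ j ∸ 1) + j)

-- D(μ) as the list of its nonzero parts (rows 1,…,|μ| suffice, since the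
-- number of rows is a₁ ≤ |μ|; zero rows are discarded)
D : List ℕ → List ℕ
D μ = filter (λ x → Relation.Nullary.¬? (x ≟ 0)) (map (DRow μ) (map suc (upTo (sum μ))))
  where import Relation.Nullary

numParts : List ℕ → ℕ
numParts ν = length (filter (λ x → Relation.Nullary.¬? (x ≟ 0)) ν)
  where import Relation.Nullary

leastMultipleAbove : (d : ℕ) .{{_ : NonZero d}} → ℕ → ℕ
leastMultipleAbove d n = ((n + (d ∸ 1)) / d) * d

-- number of beads on runner i of the minimally normalized d-abacus of ν:
-- #{ s ∈ {1,…,k} : (ν_s + k - s) mod d = i },  k = least multiple of d ≥ #parts
runnerCount : (d : ℕ) .{{_ : NonZero d}} → List ℕ → ℕ → ℕ
runnerCount d ν i =
  countUpTo k (λ s → ((at ν s + k ∸ s) % d) ≡ᵇ i)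
  where k = leastMultipleAbove d (numParts ν)

star : ℕ → ℕ → ℕ
star d zero    = zero
star d (suc i) = d ∸ suc i

-- With k beads, k a multiple of d with k ≥ a₁ (the number of rows of D(μ)), the β-set of D(μ)
-- is {k + aᵣ} ∪ ({0, …, k - 1} ∖ {k - aᵣ}): adding the largest part a to μ wraps a hook
-- around D(μ), which moves the bead at k - a to k + a. As d ∣ k, the bead k + aᵣ lies on the
-- runner of aᵣ and k - aᵣ on the runner of -aᵣ, so runners i and i* together gain exactly as
-- many beads as they lose, and xᵢ + x_{i*} = 2k/d for every i.
module Submission where

open import Defs
open import Data.Nat using (ℕ; zero; suc; NonZero; >-nonZero⁻¹; _+_; _*_; _∸_; _≤_; _<_; _≤ᵇ_; _<ᵇ_; _≡ᵇ_; z≤n; s≤s; z<s; _≟_; _≤?_; _<?_)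
open import Data.Nat.Properties
open import Data.Nat.DivMod using (_/_; _%_; m%n<n; m<n⇒m%n≡m; %-distribˡ-+; %-remove-+ʳ; [m+n]%n≡m%n; m≤n⇒[n∸m]%m≡n%m; m≡m%n+[m/n]*n)
open import Data.Nat.Divisibility using (_∣_; n∣m*n; n∣m⇒m%n≡0)
open import Data.Nat.ListAction using (sum)
open import Data.Nat.Tactic.RingSolver using (solve-∀)
open import Data.Bool using (Bool; true; false; if_then_else_)
open import Data.List using (List; []; _∷_; length; filter; map; applyUpTo; upTo)
open import Data.List.Properties using (length-applyUpTo; filter-accept; filter-reject; map-upTo; map-applyUpTo)
open import Data.List.Relation.Unary.All using ([]; _∷_)
open import Data.List.Relation.Unary.Linked using ([]; [-]; _∷_)
open import Data.Product using (_,_)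
open import Function using (_∘_; _⇔_; mk⇔)
open import Relation.Binary.PropositionalEquality
open import Relation.Nullary using (¬?; yes; no; contradiction)
open import Relation.Nullary.Decidable using (dec-true; dec-false; does-⇔)

𝟙 : Bool → ℕ
𝟙 b = if b then 1 else 0

≤ᵇ-true : ∀ {m n} → m ≤ n → (m ≤ᵇ n) ≡ true
≤ᵇ-true = dec-true (_ ≤? _)

≤ᵇ-false : ∀ {m n} → n < m → (m ≤ᵇ n) ≡ false
≤ᵇ-false = dec-false (_ ≤? _) ∘ <⇒≱

≤ᵇ-+-suc : ∀ m x n → (suc m ≤ᵇ x + suc n) ≡ (m ≤ᵇ x + n)
≤ᵇ-+-suc m x n rewrite +-suc x n with m
... | zero  = refl
... | suc _ = refl

𝟙[≡ᵇ]+𝟙[<ᵇ] : ∀ n i → 𝟙 (n ≡ᵇ i) + 𝟙 (i <ᵇ n) ≡ 𝟙 (i <ᵇ suc n)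
𝟙[≡ᵇ]+𝟙[<ᵇ] zero    zero    = refl
𝟙[≡ᵇ]+𝟙[<ᵇ] zero    (suc i) = refl
𝟙[≡ᵇ]+𝟙[<ᵇ] (suc n) zero    = refl
𝟙[≡ᵇ]+𝟙[<ᵇ] (suc n) (suc i) = 𝟙[≡ᵇ]+𝟙[<ᵇ] n i

m+x≡y+n∧o+y≡x+p⇒m+o≡n+p : ∀ {m n o p x y} → m + x ≡ y + n → o + y ≡ x + p → m + o ≡ n + p
m+x≡y+n∧o+y≡x+p⇒m+o≡n+p {m} {n} {o} {p} {x} {y} e₁ e₂ = +-cancelʳ-≡ (x + y) (m + o) (n + p) (begin
  (m + o) + (x + y) ≡⟨ shuffle m o x y ⟩
  (m + x) + (o + y) ≡⟨ cong₂ _+_ e₁ e₂ ⟩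
  (y + n) + (x + p) ≡⟨ shuffle′ y n x p ⟩
  (n + p) + (x + y) ∎)
  where
  open ≡-Reasoning
  shuffle : ∀ a b c e → (a + b) + (c + e) ≡ (a + c) + (b + e)
  shuffle = solve-∀
  shuffle′ : ∀ a b c e → (a + b) + (c + e) ≡ (b + e) + (c + a)
  shuffle′ = solve-∀

countUpTo-cong : ∀ n {p q : ℕ → Bool} → (∀ s → 1 ≤ s → s ≤ n → p s ≡ q s) →
  countUpTo n p ≡ countUpTo n q
countUpTo-cong zero    eq = refl
countUpTo-cong (suc n) eq = cong₂ _+_
  (countUpTo-cong n (λ s 1≤s s≤n → eq s 1≤s (m≤n⇒m≤1+n s≤n)))
  (cong 𝟙 (eq (suc n) (s≤s z≤n) ≤-refl))

countUpTo-none : ∀ n {p : ℕ → Bool} → (∀ s → 1 ≤ s → s ≤ n → p s ≡ false) → countUpTo n p ≡ 0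
countUpTo-none zero    none = refl
countUpTo-none (suc n) none rewrite none (suc n) (s≤s z≤n) ≤-refl =
  trans (+-identityʳ _) (countUpTo-none n (λ s 1≤s s≤n → none s 1≤s (m≤n⇒m≤1+n s≤n)))

countUpTo-+ : ∀ m n p → countUpTo (m + n) p ≡ countUpTo m p + countUpTo n (λ j → p (m + j))
countUpTo-+ m zero    p = trans (cong (λ l → countUpTo l p) (+-identityʳ m)) (sym (+-identityʳ _))
countUpTo-+ m (suc n) p rewrite +-suc m n =
  trans (cong (_+ 𝟙 (p (suc (m + n)))) (countUpTo-+ m n p))
        (+-assoc (countUpTo m p) (countUpTo n (λ j → p (m + j))) (𝟙 (p (suc (m + n)))))

countBelow : (ℕ → Bool) → ℕ → ℕ
countBelow P n = countUpTo n (λ s → P (n ∸ s))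

countBelow-suc : ∀ P n → countBelow P (suc n) ≡ 𝟙 (P n) + countBelow P n
countBelow-suc P n = countUpTo-+ 1 n _

-- With ρ the row lengths of a partition, ρ s + k ∸ s (1 ≤ s ≤ k) is its β-set with k beads.
betaCount : (ℕ → Bool) → (ℕ → ℕ) → ℕ → ℕ
betaCount P ρ k = countUpTo k (λ s → P (ρ s + k ∸ s))

betaCount-cong : ∀ P {ρ σ} k → (∀ s → ρ (suc s) ≡ σ (suc s)) → betaCount P ρ k ≡ betaCount P σ k
betaCount-cong P k ρ≗σ = countUpTo-cong k λ { (suc s) _ _ → cong (λ r → P (r + k ∸ suc s)) (ρ≗σ s) }

betaCount-split : ∀ P ρ m t k → m + t ≡ k → (∀ s → m < s → ρ s ≡ 0) →
  betaCount P ρ k ≡ countUpTo m (λ s → P (ρ s + k ∸ s)) + countBelow P t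
betaCount-split P ρ m t _ refl ρ-vanishes =
  trans (countUpTo-+ m t _) (cong (countUpTo m (λ s → P (ρ s + (m + t) ∸ s)) +_) (countUpTo-cong t emptyRow))
  where
  open ≡-Reasoning
  emptyRow : ∀ j → 1 ≤ j → j ≤ t → P (ρ (m + j) + (m + t) ∸ (m + j)) ≡ P (t ∸ j)
  emptyRow j 1≤j _ = cong P (begin
    ρ (m + j) + (m + t) ∸ (m + j) ≡⟨ cong (λ r → r + (m + t) ∸ (m + j)) (ρ-vanishes (m + j) (m<m+n m 1≤j)) ⟩
    (m + t) ∸ (m + j)             ≡⟨ [m+n]∸[m+o]≡n∸o m t j ⟩
    t ∸ j                         ∎)

largestPart : List ℕ → ℕ
largestPart []      = 0
largestPart (a ∷ _) = a

bar-tail : ∀ {a μ} → IsBarPartition (a ∷ μ) → IsBarPartition μ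
bar-tail ([-]    , _ ∷ [])  = [] , []
bar-tail (_ ∷ lk , _ ∷ pos) = lk , pos

largestPart-tail< : ∀ {a μ} → IsBarPartition (a ∷ μ) → largestPart μ < a
largestPart-tail< {μ = []}    (_ , 0<a ∷ _) = 0<a
largestPart-tail< {μ = _ ∷ _} (a>b ∷ _ , _) = a>b

bar-head>0 : ∀ {a μ} → IsBarPartition (a ∷ μ) → 0 < a
bar-head>0 (_ , 0<a ∷ _) = 0<a

length≤largestPart : ∀ {μ} → IsBarPartition μ → length μ ≤ largestPart μ
length≤largestPart {[]}    _   = z≤n
length≤largestPart {_ ∷ _} bar = ≤-<-trans (length≤largestPart (bar-tail bar)) (largestPart-tail< bar)

-- (at μ j ∸ 1) + j is the length of column j of D μ.
columnLength≤largestPart : ∀ {μ} → IsBarPartition μ → ∀ j → 1 ≤ j → j ≤ length μ →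
  (at μ j ∸ 1) + j ≤ largestPart μ
columnLength≤largestPart {a ∷ μ} bar (suc zero)    _ _         = ≤-reflexive (m∸n+n≡m (bar-head>0 bar))
columnLength≤largestPart {a ∷ μ} bar (suc (suc j)) _ (s≤s j<) = begin
  (at μ (suc j) ∸ 1) + suc (suc j) ≡⟨ +-suc (at μ (suc j) ∸ 1) (suc j) ⟩
  suc ((at μ (suc j) ∸ 1) + suc j) ≤⟨ s≤s (columnLength≤largestPart (bar-tail bar) (suc j) (s≤s z≤n) j<) ⟩
  suc (largestPart μ)              ≤⟨ largestPart-tail< bar ⟩
  a                                ∎
  where open ≤-Reasoning

DRow-∷-1 : ∀ a μ → DRow (a ∷ μ) 1 ≡ suc a
DRow-∷-1 a μ = +-comm a 1

-- D (a ∷ μ) is D μ with a hook of arm a and leg a - 1 wrapped around it.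
DRow-∷-suc : ∀ {a μ} r → 1 ≤ r → r < a → DRow (a ∷ μ) (suc r) ≡ suc (DRow μ r)
DRow-∷-suc {a} {μ} (suc r) _ r<a with r <ᵇ length μ
... | true  = +-suc (at μ (suc r)) (suc r)
... | false = begin
  countUpTo (suc (length μ)) (λ j → suc (suc r) ≤ᵇ (at (a ∷ μ) j ∸ 1) + j)
    ≡⟨ countUpTo-+ 1 (length μ) _ ⟩
  𝟙 (suc (suc r) ≤ᵇ (a ∸ 1) + 1) + countUpTo (length μ) (λ j → suc (suc r) ≤ᵇ (at (a ∷ μ) (suc j) ∸ 1) + suc j)
    ≡⟨ cong₂ _+_ (cong 𝟙 (≤ᵇ-true (subst (suc (suc r) ≤_) (sym (m∸n+n≡m (≤-trans z<s r<a))) r<a)))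
                 (countUpTo-cong (length μ) λ { (suc j) _ _ → ≤ᵇ-+-suc (suc r) (at μ (suc j) ∸ 1) (suc j) }) ⟩
  suc (countUpTo (length μ) (λ j → suc r ≤ᵇ (at μ j ∸ 1) + j)) ∎
  where open ≡-Reasoning

DRow-beyond : ∀ {μ} → IsBarPartition μ → ∀ {r} → largestPart μ < r → DRow μ r ≡ 0
DRow-beyond {[]}    _   {suc r} _   = refl
DRow-beyond {a ∷ μ} bar {r}     a<r
  rewrite ≤ᵇ-false {r} {suc (length μ)} (≤-<-trans (length≤largestPart bar) a<r) =
  countUpTo-none (suc (length μ)) λ j 1≤j j≤ →
    ≤ᵇ-false (≤-<-trans (columnLength≤largestPart bar j 1≤j j≤) a<r)

DRow-nonzero : ∀ {μ} → IsBarPartition μ → ∀ r → r < largestPart μ → DRow μ (suc r) ≢ 0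
DRow-nonzero {a ∷ μ} bar zero    _   eq = 1+n≢0 (trans (sym (DRow-∷-1 a μ)) eq)
DRow-nonzero {a ∷ μ} bar (suc r) r<a eq = 1+n≢0 (trans (sym (DRow-∷-suc {μ = μ} (suc r) (s≤s z≤n) r<a)) eq)

filter-nonzero-applyUpTo : ∀ (h : ℕ → ℕ) T N → T ≤ N →
  (∀ r → r < T → h r ≢ 0) → (∀ r → T ≤ r → h r ≡ 0) →
  filter (λ x → ¬? (x ≟ 0)) (applyUpTo h N) ≡ applyUpTo h T
filter-nonzero-applyUpTo h zero    zero    _         _       _      = refl
filter-nonzero-applyUpTo h zero    (suc N) _         _       vanish =
  trans (filter-reject (λ x → ¬? (x ≟ 0)) (λ h0≢0 → h0≢0 (vanish 0 z≤n)))
        (filter-nonzero-applyUpTo (h ∘ suc) 0 N z≤n (λ _ ()) (λ r _ → vanish (suc r) z≤n))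
filter-nonzero-applyUpTo h (suc T) (suc N) (s≤s T≤N) nonzero vanish =
  trans (filter-accept (λ x → ¬? (x ≟ 0)) (nonzero 0 z<s))
        (cong (h 0 ∷_) (filter-nonzero-applyUpTo (h ∘ suc) T N T≤N
                          (λ r → nonzero (suc r) ∘ s≤s) (λ r → vanish (suc r) ∘ s≤s)))

at-applyUpTo : ∀ (h : ℕ → ℕ) T → (∀ r → T ≤ r → h r ≡ 0) → ∀ s → at (applyUpTo h T) (suc s) ≡ h s
at-applyUpTo h zero    vanish s       = sym (vanish s z≤n)
at-applyUpTo h (suc T) vanish zero    = refl
at-applyUpTo h (suc T) vanish (suc s) = at-applyUpTo (h ∘ suc) T (λ r → vanish (suc r) ∘ s≤s) s

largestPart≤sum : ∀ μ → largestPart μ ≤ sum μ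
largestPart≤sum []      = z≤n
largestPart≤sum (a ∷ μ) = m≤m+n a (sum μ)

filter-nonzero-DRows : ∀ {μ} → IsBarPartition μ → ∀ N → largestPart μ ≤ N →
  filter (λ x → ¬? (x ≟ 0)) (applyUpTo (DRow μ ∘ suc) N) ≡ applyUpTo (DRow μ ∘ suc) (largestPart μ)
filter-nonzero-DRows {μ} bar N a₁≤N =
  filter-nonzero-applyUpTo _ (largestPart μ) N a₁≤N (DRow-nonzero bar) (λ _ → DRow-beyond bar ∘ s≤s)

D-rows : ∀ {μ} → IsBarPartition μ → D μ ≡ applyUpTo (DRow μ ∘ suc) (largestPart μ)
D-rows {μ} bar = begin
  filter (λ x → ¬? (x ≟ 0)) (map (DRow μ) (map suc (upTo (sum μ))))
    ≡⟨ cong (filter (λ x → ¬? (x ≟ 0)) ∘ map (DRow μ)) (map-upTo suc (sum μ)) ⟩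
  filter (λ x → ¬? (x ≟ 0)) (map (DRow μ) (applyUpTo suc (sum μ)))
    ≡⟨ cong (filter (λ x → ¬? (x ≟ 0))) (map-applyUpTo suc (DRow μ) (sum μ)) ⟩
  filter (λ x → ¬? (x ≟ 0)) (applyUpTo (DRow μ ∘ suc) (sum μ))
    ≡⟨ filter-nonzero-DRows bar (sum μ) (largestPart≤sum μ) ⟩
  applyUpTo (DRow μ ∘ suc) (largestPart μ) ∎
  where open ≡-Reasoning

numParts-D : ∀ {μ} → IsBarPartition μ → numParts (D μ) ≡ largestPart μ
numParts-D {μ} bar rewrite D-rows bar =
  trans (cong length (filter-nonzero-DRows bar (largestPart μ) ≤-refl)) (length-applyUpTo _ (largestPart μ))

at-D : ∀ {μ} → IsBarPartition μ → ∀ s → at (D μ) (suc s) ≡ DRow μ (suc s)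
at-D {μ} bar s rewrite D-rows bar = at-applyUpTo _ (largestPart μ) (λ _ → DRow-beyond bar ∘ s≤s) s

betaCount-[] : ∀ P k → betaCount P (DRow []) k ≡ countBelow P k
betaCount-[] P k = betaCount-split P (DRow []) 0 k k refl (λ _ → DRow-beyond ([] , []))

betaCount-∷ : ∀ P {a μ} k → IsBarPartition (a ∷ μ) → a ≤ k →
  betaCount P (DRow (a ∷ μ)) k + 𝟙 (P (k ∸ a)) ≡ 𝟙 (P (a + k)) + betaCount P (DRow μ) k
betaCount-∷ P {zero}     k bar _   with () ← bar-head>0 bar
betaCount-∷ P {suc a₀} {μ} k bar a≤k = begin
  betaCount P (DRow (suc a₀ ∷ μ)) k + 𝟙 (P t) ≡⟨ cong (_+ 𝟙 (P t)) newRows ⟩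
  𝟙 (P (suc a₀ + k)) + C + B + 𝟙 (P t)       ≡⟨ rearrange (𝟙 (P (suc a₀ + k))) C B (𝟙 (P t)) ⟩
  𝟙 (P (suc a₀ + k)) + (C + (𝟙 (P t) + B))   ≡⟨ cong (𝟙 (P (suc a₀ + k)) +_) oldRows ⟨
  𝟙 (P (suc a₀ + k)) + betaCount P (DRow μ) k ∎
  where
  open ≡-Reasoning
  t = k ∸ suc a₀
  C = countUpTo a₀ (λ s → P (DRow μ s + k ∸ s))
  B = countBelow P t

  rearrange : ∀ x c b y → x + c + b + y ≡ x + (c + (y + b))
  rearrange = solve-∀

  newRows : betaCount P (DRow (suc a₀ ∷ μ)) k ≡ 𝟙 (P (suc a₀ + k)) + C + B
  newRows = begin
    betaCount P (DRow (suc a₀ ∷ μ)) k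
      ≡⟨ betaCount-split P _ (suc a₀) t k (m+[n∸m]≡n a≤k) (λ _ → DRow-beyond bar) ⟩
    countUpTo (suc a₀) (λ s → P (DRow (suc a₀ ∷ μ) s + k ∸ s)) + B
      ≡⟨ cong (_+ B) (countUpTo-+ 1 a₀ _) ⟩
    𝟙 (P (DRow (suc a₀ ∷ μ) 1 + k ∸ 1)) + countUpTo a₀ (λ s → P (DRow (suc a₀ ∷ μ) (suc s) + k ∸ suc s)) + B
      ≡⟨ cong (_+ B) (cong₂ _+_
           (cong (λ r → 𝟙 (P (r + k ∸ 1))) (DRow-∷-1 (suc a₀) μ))
           (countUpTo-cong a₀ λ s 1≤s s≤a₀ → cong (λ r → P (r + k ∸ suc s)) (DRow-∷-suc s 1≤s (s≤s s≤a₀)))) ⟩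
    𝟙 (P (suc a₀ + k)) + C + B ∎

  oldRows : betaCount P (DRow μ) k ≡ C + (𝟙 (P t) + B)
  oldRows = begin
    betaCount P (DRow μ) k
      ≡⟨ betaCount-split P _ a₀ (suc t) k (trans (+-suc a₀ t) (m+[n∸m]≡n a≤k))
           (λ _ a₀<s → DRow-beyond (bar-tail bar) (≤-<-trans (≤-pred (largestPart-tail< bar)) a₀<s)) ⟩
    C + countBelow P (suc t) ≡⟨ cong (C +_) (countBelow-suc P t) ⟩
    C + (𝟙 (P t) + B)        ∎

n≤leastMultipleAbove : ∀ d .{{_ : NonZero d}} n → n ≤ leastMultipleAbove d n
n≤leastMultipleAbove d@(suc d-1) n = +-cancelʳ-≤ d-1 n (q * d) (begin
  n + d-1               ≡⟨ m≡m%n+[m/n]*n (n + d-1) d ⟩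
  (n + d-1) % d + q * d ≤⟨ +-monoˡ-≤ (q * d) (≤-pred (m%n<n (n + d-1) d)) ⟩
  d-1 + q * d           ≡⟨ +-comm d-1 (q * d) ⟩
  q * d + d-1           ∎)
  where
  open ≤-Reasoning
  q = (n + d-1) / d

module Runners (d : ℕ) .{{_ : NonZero d}} where

  onRunner : ℕ → ℕ → Bool
  onRunner i x = x % d ≡ᵇ i

  star-< : ∀ {i} → i < d → star d i < d
  star-< {zero}  _   = >-nonZero⁻¹ d
  star-< {suc i} i<d = ∸-monoʳ-< z<s (<⇒≤ i<d)

  star-involutive : ∀ {i} → i < d → star d (star d i) ≡ i
  star-involutive {zero}  _   = refl
  star-involutive {suc i} i<d with d ∸ suc i in eq
  ... | zero  = contradiction (m∸n≡0⇒m≤n eq) (<⇒≱ i<d)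
  ... | suc w = trans (cong (d ∸_) (sym eq)) (m∸[m∸n]≡n (<⇒≤ i<d))

  star-swap : ∀ {u i} → u < d → i < d → star d u ≡ i ⇔ u ≡ star d i
  star-swap u<d i<d = mk⇔ (λ eq → trans (sym (star-involutive u<d)) (cong (star d) eq))
                          (λ eq → trans (cong (star d) eq) (star-involutive i<d))

  residue-complement : ∀ {u v} → u < d → v < d → (v + u) % d ≡ 0 → v ≡ star d u
  residue-complement {zero} {v} _ v<d sum≡0 = begin
    v           ≡⟨ m<n⇒m%n≡m v<d ⟨
    v % d       ≡⟨ cong (_% d) (+-identityʳ v) ⟨
    (v + 0) % d ≡⟨ sum≡0 ⟩
    0           ∎
    where open ≡-Reasoning
  residue-complement {suc u} {v} u<d v<d sum≡0 with v + suc u <? d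
  ... | yes sum<d = contradiction (trans (sym (m<n⇒m%n≡m sum<d)) sum≡0) (m+1+n≢0 v)
  ... | no  sum≮d = begin
    v                 ≡⟨ m+n∸n≡m v (suc u) ⟨
    v + suc u ∸ suc u ≡⟨ cong (_∸ suc u) sum≡d ⟩
    d ∸ suc u         ∎
    where
    open ≡-Reasoning
    d≤sum : d ≤ v + suc u
    d≤sum = ≮⇒≥ sum≮d
    excess<d : v + suc u ∸ d < d
    excess<d = m<n+o⇒m∸n<o (v + suc u) d (+-mono-< v<d u<d)
    excess≡0 : v + suc u ∸ d ≡ 0
    excess≡0 = trans (sym (m<n⇒m%n≡m excess<d)) (trans (m≤n⇒[n∸m]%m≡n%m d≤sum) sum≡0)
    sum≡d : v + suc u ≡ d
    sum≡d = ≤-antisym (m∸n≡0⇒m≤n excess≡0) d≤sum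

  %-complement : ∀ {a k} → a ≤ k → d ∣ k → (k ∸ a) % d ≡ star d (a % d)
  %-complement {a} {k} a≤k d∣k = residue-complement (m%n<n a d) (m%n<n (k ∸ a) d) (begin
    ((k ∸ a) % d + a % d) % d ≡⟨ %-distribˡ-+ (k ∸ a) a d ⟨
    (k ∸ a + a) % d           ≡⟨ cong (_% d) (m∸n+n≡m a≤k) ⟩
    k % d                     ≡⟨ n∣m⇒m%n≡0 k d d∣k ⟩
    0                         ∎)
    where open ≡-Reasoning

  onRunner-reflect : ∀ {i a k} → i < d → a ≤ k → d ∣ k →
    onRunner i (k ∸ a) ≡ onRunner (star d i) (a + k)
  onRunner-reflect {i} {a} {k} i<d a≤k d∣k = begin
    (k ∸ a) % d ≡ᵇ i        ≡⟨ cong (_≡ᵇ i) (%-complement a≤k d∣k) ⟩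
    star d (a % d) ≡ᵇ i     ≡⟨ does-⇔ (star-swap (m%n<n a d) i<d) (_ ≟ _) (_ ≟ _) ⟩
    a % d ≡ᵇ star d i       ≡⟨ cong (_≡ᵇ star d i) (%-remove-+ʳ a d∣k) ⟨
    (a + k) % d ≡ᵇ star d i ∎
    where open ≡-Reasoning

  countBelow-onRunner-≤d : ∀ i n → n ≤ d → countBelow (onRunner i) n ≡ 𝟙 (i <ᵇ n)
  countBelow-onRunner-≤d i zero    _   = refl
  countBelow-onRunner-≤d i (suc n) n<d = begin
    countBelow (onRunner i) (suc n)           ≡⟨ countBelow-suc (onRunner i) n ⟩
    𝟙 (n % d ≡ᵇ i) + countBelow (onRunner i) n ≡⟨ cong₂ _+_ (cong (λ r → 𝟙 (r ≡ᵇ i)) (m<n⇒m%n≡m n<d))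
                                                            (countBelow-onRunner-≤d i n (<⇒≤ n<d)) ⟩
    𝟙 (n ≡ᵇ i) + 𝟙 (i <ᵇ n)                   ≡⟨ 𝟙[≡ᵇ]+𝟙[<ᵇ] n i ⟩
    𝟙 (i <ᵇ suc n)                            ∎
    where open ≡-Reasoning

  countBelow-onRunner-+d : ∀ {i} → i < d → ∀ n →
    countBelow (onRunner i) (n + d) ≡ suc (countBelow (onRunner i) n)
  countBelow-onRunner-+d {i} i<d zero =
    trans (countBelow-onRunner-≤d i d ≤-refl) (cong 𝟙 (dec-true (i <? d) i<d))
  countBelow-onRunner-+d {i} i<d (suc n) = begin
    countBelow (onRunner i) (suc (n + d))
      ≡⟨ countBelow-suc (onRunner i) (n + d) ⟩
    𝟙 ((n + d) % d ≡ᵇ i) + countBelow (onRunner i) (n + d)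
      ≡⟨ cong₂ _+_ (cong (λ r → 𝟙 (r ≡ᵇ i)) ([m+n]%n≡m%n n d)) (countBelow-onRunner-+d i<d n) ⟩
    𝟙 (n % d ≡ᵇ i) + suc (countBelow (onRunner i) n)
      ≡⟨ +-suc _ _ ⟩
    suc (𝟙 (n % d ≡ᵇ i) + countBelow (onRunner i) n)
      ≡⟨ cong suc (countBelow-suc (onRunner i) n) ⟨
    suc (countBelow (onRunner i) (suc n)) ∎
    where open ≡-Reasoning

  countBelow-onRunner-* : ∀ {i} → i < d → ∀ q → countBelow (onRunner i) (q * d) ≡ q
  countBelow-onRunner-* i<d zero    = refl
  countBelow-onRunner-* {i} i<d (suc q) =
    trans (cong (countBelow (onRunner i)) (+-comm d (q * d)))
          (trans (countBelow-onRunner-+d i<d (q * d)) (cong suc (countBelow-onRunner-* i<d q)))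

  DRow-runner+star : ∀ {μ} q {i} → IsBarPartition μ → largestPart μ ≤ q * d → i < d →
    betaCount (onRunner i) (DRow μ) (q * d) + betaCount (onRunner (star d i)) (DRow μ) (q * d) ≡ q + q
  DRow-runner+star {[]} q {i} _ _ i<d = cong₂ _+_
    (trans (betaCount-[] (onRunner i) (q * d)) (countBelow-onRunner-* i<d q))
    (trans (betaCount-[] (onRunner (star d i)) (q * d)) (countBelow-onRunner-* (star-< i<d) q))
  DRow-runner+star {a ∷ μ} q {i} bar a≤k i<d =
    trans (m+x≡y+n∧o+y≡x+p⇒m+o≡n+p {B i (a ∷ μ)} {B i μ} {B i* (a ∷ μ)} {B i* μ} {X} {Y}
             (betaCount-∷ (onRunner i) k bar a≤k) moved*)
          (DRow-runner+star q (bar-tail bar) (≤-trans (<⇒≤ (largestPart-tail< bar)) a≤k) i<d)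
    where
    k = q * d
    i* = star d i
    d∣k : d ∣ k
    d∣k = n∣m*n q
    B : ℕ → List ℕ → ℕ
    B j ν = betaCount (onRunner j) (DRow ν) k
    X = 𝟙 (onRunner i (k ∸ a))
    Y = 𝟙 (onRunner i (a + k))
    moved* : B i* (a ∷ μ) + Y ≡ X + B i* μ
    moved* = subst₂ (λ y x → B i* (a ∷ μ) + 𝟙 y ≡ 𝟙 x + B i* μ)
      (trans (onRunner-reflect (star-< i<d) a≤k d∣k) (cong (λ j → onRunner j (a + k)) (star-involutive i<d)))
      (sym (onRunner-reflect i<d a≤k d∣k))
      (betaCount-∷ (onRunner i*) k bar a≤k)

lemma3p3 : (d : ℕ) .{{_ : NonZero d}} → 3 ≤ d → Odd d → (μ : List ℕ) → IsBarPartition μ →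
    (i j : ℕ) → i < d → j < d →
    runnerCount d (D μ) i + runnerCount d (D μ) (star d i)
      ≡ runnerCount d (D μ) j + runnerCount d (D μ) (star d j)
lemma3p3 d _ _ μ bar i j i<d j<d = trans (runnerCount-D+star i<d) (sym (runnerCount-D+star j<d))
  where
  open Runners d
  q = (numParts (D μ) + (d ∸ 1)) / d

  largestPart≤qd : largestPart μ ≤ q * d
  largestPart≤qd = subst (_≤ q * d) (numParts-D bar) (n≤leastMultipleAbove d (numParts (D μ)))

  runnerCount-D+star : ∀ {i} → i < d → runnerCount d (D μ) i + runnerCount d (D μ) (star d i) ≡ q + q
  runnerCount-D+star {i} i<d = trans
    (cong₂ _+_ (betaCount-cong (onRunner i) (q * d) (at-D bar))
               (betaCount-cong (onRunner (star d i)) (q * d) (at-D bar)))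
    (DRow-runner+star q bar largestPart≤qd i<d)
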